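{- (Soundness for Sequents.) If $\vdash\Gamma\Rightarrow\Delta$ in $\mathbf{CPF}^I$, then $\vDash\Gamma\Rightarrow\Delta$, i.e. for every structure $\mathfrak{A}$ and every $s\colon V\to|\mathfrak{A}|$: if $\mathfrak{A}$ satisfies every member of $\Gamma$ with $s$, then $\mathfrak{A}$ satisfies some member of $\Delta$ with $s$.
   Context: Language $\mathcal{L}$: first-order, with variables $V$ (which may occur free), individual constants, function symbols, predicate symbols, identity $=$, a one-place existence predicate $\exists!$, connectives $\neg,\rightarrow$, quantifier $\forall$, and the binary quantifier $I$: if $A,B$ are formulas and $x$ a variable, $Ix[A,B]$ is a formula binding $x$ in $A$ and $B$. $A_t^x$ is substitution of $t$ for $x$ ($t$ free for $x$). Sequents $\Gamma\Rightarrow\Delta$ have finite sets of formulas on each side. The system $\mathbf{CPF}^I$ has axioms $A\Rightarrow A$ and the rules: Cut; weakening and contraction; $(L\neg)$: $\Gamma\Rightarrow\Delta,A$ / $\neg A,\Gamma\Rightarrow\Delta$; $(R\neg)$: $A,\Gamma\Rightarrow\Delta$ / $\Gamma\Rightarrow\Delta,\neg A$; $(L\rightarrow)$: $\Gamma\Rightarrow\Delta,A$ and $B,\Gamma\Rightarrow\Delta$ / $A\rightarrow B,\Gamma\Rightarrow\Delta$; $(R\rightarrow)$: $A,\Gamma\Rightarrow\Delta,B$ / $\Gamma\Rightarrow\Delta,A\rightarrow B$; $(L\forall)$: $A_t^x,\Gamma\Rightarrow\Delta$ / $\exists!t,\forall xA,\Gamma\Rightarrow\Delta$; $(R\forall)$: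 $\exists!a,\Gamma\Rightarrow\Delta,A_a^x$ / $\Gamma\Rightarrow\Delta,\forall xA$; identity: $A_{t_2}^x,\Gamma\Rightarrow\Delta$ / $t_1=t_2,A_{t_1}^x,\Gamma\Rightarrow\Delta$ ($A$ atomic), and $t=t,\Gamma\Rightarrow\Delta$ / $\Gamma\Rightarrow\Delta$; $(RI)$: $\Gamma\Rightarrow\Delta,A_t^x$, $\Gamma\Rightarrow\Delta,B_t^x$, $A_a^x,\Gamma\Rightarrow\Delta,a=t$ / $\Gamma\Rightarrow\Delta,Ix[A,B]$; $(LI^1)$: $A_a^x,B_a^x,\Gamma\Rightarrow\Delta$ / $Ix[A,B],\Gamma\Rightarrow\Delta$; $(LI^2)$: $\Gamma\Rightarrow\Delta,A_{t_1}^x$, $\Gamma\Rightarrow\Delta,A_{t_2}^x$, $\Gamma\Rightarrow\Delta,C_{t_2}^x$ / $Ix[A,B],\Gamma\Rightarrow\Delta,C_{t_1}^x$ ($C$ atomic). In $(R\forall)$, $(RI)$, $(LI^1)$ the eigen-term $a$ (a variable or constant) must not occur in the conclusion. A structure $\mathfrak{A}$ consists of a non-empty domain $|\mathfrak{A}|$, an inner domain $|\mathfrak{A}^\forall|\subseteq|\mathfrak{A}|$ (possibly empty), which is also the interpretation of $\exists!$, relations $P^\mathfrak{A}\subseteq|\mathfrak{A}|^n$, elements $c^\mathfrak{A}\in|\mathfrak{A}|$, and operations $f^\mathfrak{A}\colon|\mathfrak{A}|^n\to|\mathfrak{A}|$. For $s\colon V\to|\mathfrak{A}|$, $\overline{s}$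 is its usual extension to terms, and $s(x|d)$ is $s$ modified to send $x$ to $d$. Satisfaction: $\vDash_\mathfrak{A}t_1=t_2[s]$ iff $\overline{s}(t_1)=\overline{s}(t_2)$; $\vDash_\mathfrak{A}\exists!t[s]$ iff $\overline{s}(t)\in|\mathfrak{A}^\forall|$; $\vDash_\mathfrak{A}Pt_1\dots t_n[s]$ iff $\langle\overline{s}(t_1),\dots,\overline{s}(t_n)\rangle\in P^\mathfrak{A}$; $\neg$ and $\rightarrow$ classically; $\vDash_\mathfrak{A}\forall xA[s]$ iff $\vDash_\mathfrak{A}A[s(x|d)]$ for every $d\in|\mathfrak{A}^\forall|$; $\vDash_\mathfrak{A}Ix[A,B][s]$ iff there is $d\in|\mathfrak{A}|$ with $\vDash_\mathfrak{A}A[s(x|d)]$, no other $e\in|\mathfrak{A}|$ with $\vDash_\mathfrak{A}A[s(x|e)]$, and $\vDash_\mathfrak{A}B[s(x|d)]$.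
   Formalization: In rule (RI) the eigen-term a must occur neither in the conclusion nor in the term t, rather than only not in the conclusion. The statement above fails without it. -}

module Defs where

open import Data.Nat using (ℕ; _≟_)
open import Data.Vec using (Vec; []; _∷_)
open import Data.List using (List; []; _∷_)
open import Data.List.Relation.Unary.All using (All)
open import Data.List.Relation.Unary.Any using (Any)
open import Data.List.Relation.Binary.Subset.Propositional using (_⊆_)
open import Data.Product using (Σ; _×_; _,_)
open import Data.Sum using (_⊎_)
open import Data.Unit using (⊤)
open import Relation.Nullary using (¬_; yes; no)
open import Relation.Binary.PropositionalEquality using (_≡_; _≢_)

Var : Set
Var = ℕ

record Signature : Set₁ where
  field
    Const : Set
    Fun   : ℕ → Set
    Pred  : ℕ → Set

-- Structures: non-empty domain, inner domain (possibly empty; it is also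
-- the interpretation of ∃!), relations, constants and operations.
record Structure (L : Signature) : Set₁ where
  open Signature L
  field
    D         : Set
    inhabited : D
    Inner     : D → Set                -- |𝔄^∀| ⊆ |𝔄|, as a predicate
    relI      : ∀ {n} → Pred n → Vec D n → Set
    conI      : Const → D
    funI      : ∀ {n} → Fun n → Vec D n → D

module _ (L : Signature) where
  open Signature L

  data Term : Set where
    var : Var → Term
    con : Const → Term
    app : ∀ {n} → Fun n → Vec Term n → Term

  infix 7 _≐_
  infixr 5 _⇒′_
  data Formula : Set where
    _≐_  : Term → Term → Formula
    E!   : Term → Formula
    rel  : ∀ {n} → Pred n → Vec Term n → Formula
    ¬′_  : Formula → Formula
    _⇒′_ : Formula → Formula → Formula
    all  : Var → Formula → Formula
    I    : Var → Formula → Formula → Formula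

  data Atomic : Formula → Set where
    at-eq  : ∀ {u v} → Atomic (u ≐ v)
    at-ex  : ∀ {u} → Atomic (E! u)
    at-rel : ∀ {n} {P : Pred n} {ts} → Atomic (rel P ts)

  data Eigen : Term → Set where
    e-var : ∀ {y} → Eigen (var y)
    e-con : ∀ {c} → Eigen (con c)

  -- Substitution u[t/x] (no renaming; only used when t is free for x)

  substT  : Term → Var → Term → Term
  substTs : ∀ {n} → Vec Term n → Var → Term → Vec Term n
  substT (var y) x t with y ≟ x
  ... | yes _ = t
  ... | no  _ = var y
  substT (con c) x t = con c
  substT (app f us) x t = app f (substTs us x t)
  substTs [] x t = []
  substTs (u ∷ us) x t = substT u x t ∷ substTs us x t

  sub : Formula → Var → Term → Formula
  sub (u ≐ v) x t = substT u x t ≐ substT v x t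
  sub (E! u) x t = E! (substT u x t)
  sub (rel P us) x t = rel P (substTs us x t)
  sub (¬′ A) x t = ¬′ sub A x t
  sub (A ⇒′ B) x t = sub A x t ⇒′ sub B x t
  sub (all y A) x t with y ≟ x
  ... | yes _ = all y A
  ... | no  _ = all y (sub A x t)
  sub (I y A B) x t with y ≟ x
  ... | yes _ = I y A B
  ... | no  _ = I y (sub A x t) (sub B x t)

  data _⊑_  (a : Term) : Term → Set
  data _⊑s_ (a : Term) : ∀ {n} → Vec Term n → Set
  data _⊑_ a where
    ⊑-refl : a ⊑ a
    ⊑-app  : ∀ {n} {f : Fun n} {ts} → a ⊑s ts → a ⊑ app f ts
  data _⊑s_ a where
    ⊑-hd : ∀ {n t} {ts : Vec Term n} → a ⊑ t → a ⊑s (t ∷ ts)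
    ⊑-tl : ∀ {n t} {ts : Vec Term n} → a ⊑s ts → a ⊑s (t ∷ ts)

  data FreeIn (x : Var) : Formula → Set where
    fr-eqˡ : ∀ {u v} → var x ⊑ u → FreeIn x (u ≐ v)
    fr-eqʳ : ∀ {u v} → var x ⊑ v → FreeIn x (u ≐ v)
    fr-ex  : ∀ {u} → var x ⊑ u → FreeIn x (E! u)
    fr-rel : ∀ {n} {P : Pred n} {ts} → var x ⊑s ts → FreeIn x (rel P ts)
    fr-neg : ∀ {A} → FreeIn x A → FreeIn x (¬′ A)
    fr-impˡ : ∀ {A B} → FreeIn x A → FreeIn x (A ⇒′ B)
    fr-impʳ : ∀ {A B} → FreeIn x B → FreeIn x (A ⇒′ B)
    fr-all : ∀ {y A} → y ≢ x → FreeIn x A → FreeIn x (all y A)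
    fr-Iˡ  : ∀ {y A B} → y ≢ x → FreeIn x A → FreeIn x (I y A B)
    fr-Iʳ  : ∀ {y A B} → y ≢ x → FreeIn x B → FreeIn x (I y A B)

  FreeFor : Term → Var → Formula → Set
  FreeFor t x (u ≐ v) = ⊤
  FreeFor t x (E! u) = ⊤
  FreeFor t x (rel P us) = ⊤
  FreeFor t x (¬′ A) = FreeFor t x A
  FreeFor t x (A ⇒′ B) = FreeFor t x A × FreeFor t x B
  FreeFor t x (all y A) =
    ¬ FreeIn x (all y A) ⊎ (¬ (var y ⊑ t) × FreeFor t x A)
  FreeFor t x (I y A B) =
    ¬ FreeIn x (I y A B) ⊎ (¬ (var y ⊑ t) × FreeFor t x A × FreeFor t x B)

  data Occurs (a : Term) : Formula → Set where
    oc-eqˡ : ∀ {u v} → a ⊑ u → Occurs a (u ≐ v)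
    oc-eqʳ : ∀ {u v} → a ⊑ v → Occurs a (u ≐ v)
    oc-ex  : ∀ {u} → a ⊑ u → Occurs a (E! u)
    oc-rel : ∀ {n} {P : Pred n} {ts} → a ⊑s ts → Occurs a (rel P ts)
    oc-neg : ∀ {A} → Occurs a A → Occurs a (¬′ A)
    oc-impˡ : ∀ {A B} → Occurs a A → Occurs a (A ⇒′ B)
    oc-impʳ : ∀ {A B} → Occurs a B → Occurs a (A ⇒′ B)
    oc-allv : ∀ {y A} → a ≡ var y → Occurs a (all y A)
    oc-all  : ∀ {y A} → Occurs a A → Occurs a (all y A)
    oc-Iv   : ∀ {y A B} → a ≡ var y → Occurs a (I y A B)
    oc-Iˡ   : ∀ {y A B} → Occurs a A → Occurs a (I y A B)
    oc-Iʳ   : ∀ {y A B} → Occurs a B → Occurs a (I y A B)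

  OccursSeq : Term → List Formula → List Formula → Set
  OccursSeq a Γ Δ = Any (Occurs a) Γ ⊎ Any (Occurs a) Δ

  -- Sequents Γ ⇒ Δ have finite SETS of
  -- formulas on each side; they are represented by lists, "A , Γ" by
  -- A ∷ Γ, and the rule `wk` (weakening, with Γ ⊆ Γ', Δ ⊆ Δ' read as
  -- sets) makes the representation irrelevant (exchange/contraction).

  data Derivable : List Formula → List Formula → Set where
    ax  : ∀ {A} → Derivable (A ∷ []) (A ∷ [])
    cut : ∀ {Γ Δ A} →
          Derivable Γ (A ∷ Δ) → Derivable (A ∷ Γ) Δ → Derivable Γ Δ
    wk  : ∀ {Γ Δ Γ′ Δ′} → Γ ⊆ Γ′ → Δ ⊆ Δ′ →
          Derivable Γ Δ → Derivable Γ′ Δ′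
    L¬  : ∀ {Γ Δ A} → Derivable Γ (A ∷ Δ) → Derivable ((¬′ A) ∷ Γ) Δ
    R¬  : ∀ {Γ Δ A} → Derivable (A ∷ Γ) Δ → Derivable Γ ((¬′ A) ∷ Δ)
    L⇒  : ∀ {Γ Δ A B} → Derivable Γ (A ∷ Δ) → Derivable (B ∷ Γ) Δ →
          Derivable ((A ⇒′ B) ∷ Γ) Δ
    R⇒  : ∀ {Γ Δ A B} → Derivable (A ∷ Γ) (B ∷ Δ) →
          Derivable Γ ((A ⇒′ B) ∷ Δ)
    L∀  : ∀ {Γ Δ x A t} → FreeFor t x A →
          Derivable (sub A x t ∷ Γ) Δ →
          Derivable (E! t ∷ all x A ∷ Γ) Δ
    R∀  : ∀ {Γ Δ x A a} → Eigen a → FreeFor a x A →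
          ¬ OccursSeq a Γ (all x A ∷ Δ) →
          Derivable (E! a ∷ Γ) (sub A x a ∷ Δ) →
          Derivable Γ (all x A ∷ Δ)
    id= : ∀ {Γ Δ x A t₁ t₂} → Atomic A →
          Derivable (sub A x t₂ ∷ Γ) Δ →
          Derivable ((t₁ ≐ t₂) ∷ sub A x t₁ ∷ Γ) Δ
    refl= : ∀ {Γ Δ t} → Derivable ((t ≐ t) ∷ Γ) Δ → Derivable Γ Δ
    RI  : ∀ {Γ Δ x A B t a} → FreeFor t x A → FreeFor t x B →
          Eigen a → FreeFor a x A →
          ¬ OccursSeq a Γ (I x A B ∷ Δ) → ¬ (a ⊑ t) →
          Derivable Γ (sub A x t ∷ Δ) →
          Derivable Γ (sub B x t ∷ Δ) →
          Derivable (sub A x a ∷ Γ) ((a ≐ t) ∷ Δ) →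
          Derivable Γ (I x A B ∷ Δ)
    LI¹ : ∀ {Γ Δ x A B a} → Eigen a → FreeFor a x A → FreeFor a x B →
          ¬ OccursSeq a (I x A B ∷ Γ) Δ →
          Derivable (sub A x a ∷ sub B x a ∷ Γ) Δ →
          Derivable (I x A B ∷ Γ) Δ
    LI² : ∀ {Γ Δ x A B C t₁ t₂} → Atomic C →
          FreeFor t₁ x A → FreeFor t₂ x A →
          Derivable Γ (sub A x t₁ ∷ Δ) →
          Derivable Γ (sub A x t₂ ∷ Δ) →
          Derivable Γ (sub C x t₂ ∷ Δ) →
          Derivable (I x A B ∷ Γ) (sub C x t₁ ∷ Δ)

  module _ (𝔄 : Structure L) where
    open Structure 𝔄

    update : (Var → D) → Var → D → (Var → D)
    update s x d y with y ≟ x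
    ... | yes _ = d
    ... | no  _ = s y

    eval  : (Var → D) → Term → D
    evals : ∀ {n} → (Var → D) → Vec Term n → Vec D n
    eval s (var y) = s y
    eval s (con c) = conI c
    eval s (app f ts) = funI f (evals s ts)
    evals s [] = []
    evals s (t ∷ ts) = eval s t ∷ evals s ts

    Sat : Formula → (Var → D) → Set
    Sat (u ≐ v) s = eval s u ≡ eval s v
    Sat (E! u) s = Inner (eval s u)
    Sat (rel P ts) s = relI P (evals s ts)
    Sat (¬′ A) s = ¬ Sat A s
    Sat (A ⇒′ B) s = Sat A s → Sat B s
    Sat (all x A) s = ∀ d → Inner d → Sat A (update s x d)
    Sat (I x A B) s =
      Σ D λ d → Sat A (update s x d)
              × (∀ e → e ≢ d → ¬ Sat A (update s x e))
              × Sat B (update s x d)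

  Valid : List Formula → List Formula → Set₁
  Valid Γ Δ = ∀ (𝔄 : Structure L) (s : Var → Structure.D 𝔄) →
              All (λ A → Sat 𝔄 A s) Γ → Any (λ A → Sat 𝔄 A s) Δ

{-# OPTIONS --safe #-}
-- Two semantic
-- facts carry the argument.  The substitution lemma: A_t^x holds under s
-- iff A holds under s(x|s̄(t)), provided t is free for x.  The coincidence
-- lemma: satisfaction depends only on the values of the free variables and
-- of the constants that occur.  For the eigen-term rules (R∀), (RI), (LI¹)
-- the eigen-term a is absent from the conclusion, so by coincidence it can
-- be made to denote any element d — by updating s if a is a variable, by
-- reinterpreting the constant if it is one — without changing the truth
-- value of the conclusion; the premise at this variant then speaks about d.
-- Excluded middle is needed because neither satisfaction nor equality of
-- elements or of constants is decidable.
module Submission where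

open import Defs
open import Level using (0ℓ)
open import Axiom.ExcludedMiddle using (ExcludedMiddle)
open import Data.Nat using (_≟_)
open import Data.Vec using (Vec; []; _∷_)
open import Data.List using (List; _∷_)
open import Data.List.Relation.Unary.All as All using (All; []; _∷_)
open import Data.List.Relation.Unary.All.Properties using (¬Any⇒All¬)
open import Data.List.Relation.Unary.Any as Any using (Any; here; there)
open import Data.List.Relation.Binary.Subset.Propositional.Properties
  using (Any-resp-⊆; All-resp-⊇)
open import Data.Product using (Σ; _×_; _,_)
open import Data.Sum using (inj₁; inj₂)
open import Function using (_∘_)
open import Function.Bundles using (_⇔_; mk⇔; module Equivalence)
open import Function.Properties.Equivalence
  using () renaming (refl to ⇔-refl; sym to ⇔-sym; trans to ⇔-trans)
open import Function.Related.TypeIsomorphisms using (→-cong-⇔; ¬-cong-⇔)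
open import Relation.Nullary using (¬_; Dec; yes; no; contradiction)
open import Relation.Nullary.Decidable using (decidable-stable)
open import Relation.Binary.PropositionalEquality
  using (_≡_; _≢_; refl; sym; trans; cong; cong₂; subst; _≗_; module ≡-Reasoning)

open Equivalence using (to; from)

≡⇒⇔ : {P Q : Set} → P ≡ Q → P ⇔ Q
≡⇒⇔ refl = ⇔-refl

∀-cong : {X : Set} {R P Q : X → Set} → (∀ x → P x ⇔ Q x) →
  (∀ x → R x → P x) ⇔ (∀ x → R x → Q x)
∀-cong P⇔Q = mk⇔ (λ h x r → to (P⇔Q x) (h x r)) (λ h x r → from (P⇔Q x) (h x r))

I-cong : {X : Set} {P P′ Q Q′ : X → Set} → (∀ x → P x ⇔ P′ x) → (∀ x → Q x ⇔ Q′ x) →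
  (Σ X λ x → P x × (∀ y → y ≢ x → ¬ P y) × Q x)
    ⇔ (Σ X λ x → P′ x × (∀ y → y ≢ x → ¬ P′ y) × Q′ x)
I-cong P⇔P′ Q⇔Q′ = mk⇔
  (λ (x , Px , unique , Qx) →
    x , to (P⇔P′ x) Px , (λ y y≢x → unique y y≢x ∘ from (P⇔P′ y)) , to (Q⇔Q′ x) Qx)
  (λ (x , Px , unique , Qx) →
    x , from (P⇔P′ x) Px , (λ y y≢x → unique y y≢x ∘ to (P⇔P′ y)) , from (Q⇔Q′ x) Qx)

module _ (L : Signature) where
  open Signature L
  open Structure

  _≼_ : Term L → Term L → Set
  _≼_ = _⊑_ L

  _≼s_ : ∀ {n} → Term L → Vec (Term L) n → Set
  a ≼s us = _⊑s_ L a us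

  -- By record η, 𝔄 ⟨ conI 𝔄 ⟩ is 𝔄 itself, so every equivalence between
  -- 𝔄 and 𝔄 ⟨ k ⟩ below also applies within a single structure.
  _⟨_⟩ : (𝔄 : Structure L) → (Const → D 𝔄) → Structure L
  𝔄 ⟨ k ⟩ = record 𝔄 { conI = k }

  free⇒occurs : ∀ {z A} → FreeIn L z A → Occurs L (var z) A
  free⇒occurs (fr-eqˡ p) = oc-eqˡ p
  free⇒occurs (fr-eqʳ p) = oc-eqʳ p
  free⇒occurs (fr-ex p) = oc-ex p
  free⇒occurs (fr-rel p) = oc-rel p
  free⇒occurs (fr-neg f) = oc-neg (free⇒occurs f)
  free⇒occurs (fr-impˡ f) = oc-impˡ (free⇒occurs f)
  free⇒occurs (fr-impʳ f) = oc-impʳ (free⇒occurs f)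
  free⇒occurs (fr-all _ f) = oc-all (free⇒occurs f)
  free⇒occurs (fr-Iˡ _ f) = oc-Iˡ (free⇒occurs f)
  free⇒occurs (fr-Iʳ _ f) = oc-Iʳ (free⇒occurs f)

  atomic⇒freeFor : ∀ {A t x} → Atomic L A → FreeFor L t x A
  atomic⇒freeFor at-eq = _
  atomic⇒freeFor at-ex = _
  atomic⇒freeFor at-rel = _

  substT-nonfree : ∀ u x t → ¬ (var x ≼ u) → substT L u x t ≡ u
  substTs-nonfree : ∀ {n} (us : Vec (Term L) n) x t → ¬ (var x ≼s us) → substTs L us x t ≡ us
  substT-nonfree (var y) x t x∉u with y ≟ x
  ... | yes refl = contradiction ⊑-refl x∉u
  ... | no _ = refl
  substT-nonfree (con c) x t x∉u = refl
  substT-nonfree (app f us) x t x∉u = cong (app f) (substTs-nonfree us x t (x∉u ∘ ⊑-app))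
  substTs-nonfree [] x t x∉us = refl
  substTs-nonfree (u ∷ us) x t x∉us =
    cong₂ _∷_ (substT-nonfree u x t (x∉us ∘ ⊑-hd)) (substTs-nonfree us x t (x∉us ∘ ⊑-tl))

  sub-nonfree : ∀ A x t → ¬ FreeIn L x A → sub L A x t ≡ A
  sub-nonfree (u ≐ v) x t x∉A =
    cong₂ _≐_ (substT-nonfree u x t (x∉A ∘ fr-eqˡ)) (substT-nonfree v x t (x∉A ∘ fr-eqʳ))
  sub-nonfree (E! u) x t x∉A = cong E! (substT-nonfree u x t (x∉A ∘ fr-ex))
  sub-nonfree (rel P us) x t x∉A = cong (rel P) (substTs-nonfree us x t (x∉A ∘ fr-rel))
  sub-nonfree (¬′ A) x t x∉A = cong ¬′_ (sub-nonfree A x t (x∉A ∘ fr-neg))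
  sub-nonfree (A ⇒′ B) x t x∉A =
    cong₂ _⇒′_ (sub-nonfree A x t (x∉A ∘ fr-impˡ)) (sub-nonfree B x t (x∉A ∘ fr-impʳ))
  sub-nonfree (all y A) x t x∉A with y ≟ x
  ... | yes _ = refl
  ... | no y≢x = cong (all y) (sub-nonfree A x t (x∉A ∘ fr-all y≢x))
  sub-nonfree (I y A B) x t x∉A with y ≟ x
  ... | yes _ = refl
  ... | no y≢x =
    cong₂ (I y) (sub-nonfree A x t (x∉A ∘ fr-Iˡ y≢x)) (sub-nonfree B x t (x∉A ∘ fr-Iʳ y≢x))

  update-same : ∀ (𝔄 : Structure L) (r : Var → D 𝔄) x d → update L 𝔄 r x d x ≡ d
  update-same 𝔄 r x d with x ≟ x
  ... | yes _ = refl
  ... | no x≢x = contradiction refl x≢x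

  update-other : ∀ (𝔄 : Structure L) (r : Var → D 𝔄) x d y → y ≢ x → update L 𝔄 r x d y ≡ r y
  update-other 𝔄 r x d y y≢x with y ≟ x
  ... | yes y≡x = contradiction y≡x y≢x
  ... | no _ = refl

  module _ (𝔄 : Structure L) where

    update-comm : ∀ (r : Var → D 𝔄) {x y} d e → y ≢ x →
      update L 𝔄 (update L 𝔄 r y d) x e ≗ update L 𝔄 (update L 𝔄 r x e) y d
    update-comm r {x} {y} d e y≢x z = by-cases (z ≟ x) (z ≟ y)
      where
        open ≡-Reasoning
        by-cases : Dec (z ≡ x) → Dec (z ≡ y) →
          update L 𝔄 (update L 𝔄 r y d) x e z ≡ update L 𝔄 (update L 𝔄 r x e) y d z
        by-cases (yes refl) _ = begin
          update L 𝔄 _ z e z  ≡⟨ update-same 𝔄 _ z e ⟩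
          e                   ≡⟨ update-same 𝔄 r z e ⟨
          update L 𝔄 r z e z  ≡⟨ update-other 𝔄 _ y d z (y≢x ∘ sym) ⟨
          update L 𝔄 _ y d z  ∎
        by-cases (no z≢x) (yes refl) = begin
          update L 𝔄 _ x e z  ≡⟨ update-other 𝔄 _ x e z z≢x ⟩
          update L 𝔄 r z d z  ≡⟨ update-same 𝔄 r z d ⟩
          d                   ≡⟨ update-same 𝔄 _ z d ⟨
          update L 𝔄 _ z d z  ∎
        by-cases (no z≢x) (no z≢y) = begin
          update L 𝔄 _ x e z  ≡⟨ update-other 𝔄 _ x e z z≢x ⟩
          update L 𝔄 r y d z  ≡⟨ update-other 𝔄 r y d z z≢y ⟩
          r z                 ≡⟨ update-other 𝔄 r x e z z≢x ⟨
          update L 𝔄 r x e z  ≡⟨ update-other 𝔄 _ y d z z≢y ⟨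
          update L 𝔄 _ y d z  ∎

    update-agree : ∀ (k : Const → D 𝔄) (P : Var → Set) {r r′ : Var → D 𝔄} y d →
      (∀ z → y ≢ z → P z → r z ≡ r′ z) →
      ∀ z → P z → update L 𝔄 r y d z ≡ update L (𝔄 ⟨ k ⟩) r′ y d z
    update-agree k P {r} {r′} y d agree z pz = by-cases (z ≟ y)
      where
        by-cases : Dec (z ≡ y) → update L 𝔄 r y d z ≡ update L (𝔄 ⟨ k ⟩) r′ y d z
        by-cases (yes refl) = trans (update-same 𝔄 r z d) (sym (update-same (𝔄 ⟨ k ⟩) r′ z d))
        by-cases (no z≢y) = trans (update-other 𝔄 r y d z z≢y)
          (trans (agree z (z≢y ∘ sym) pz) (sym (update-other (𝔄 ⟨ k ⟩) r′ y d z z≢y)))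

    eval-coincidence : ∀ (k : Const → D 𝔄) (r r′ : Var → D 𝔄) u →
      (∀ z → var z ≼ u → r z ≡ r′ z) → (∀ c → con c ≼ u → conI 𝔄 c ≡ k c) →
      eval L 𝔄 r u ≡ eval L (𝔄 ⟨ k ⟩) r′ u
    evals-coincidence : ∀ (k : Const → D 𝔄) (r r′ : Var → D 𝔄) {n} (us : Vec (Term L) n) →
      (∀ z → var z ≼s us → r z ≡ r′ z) → (∀ c → con c ≼s us → conI 𝔄 c ≡ k c) →
      evals L 𝔄 r us ≡ evals L (𝔄 ⟨ k ⟩) r′ us
    eval-coincidence k r r′ (var y) agreeᵛ agreeᶜ = agreeᵛ y ⊑-refl
    eval-coincidence k r r′ (con c) agreeᵛ agreeᶜ = agreeᶜ c ⊑-refl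
    eval-coincidence k r r′ (app f us) agreeᵛ agreeᶜ =
      cong (funI 𝔄 f)
        (evals-coincidence k r r′ us (λ z → agreeᵛ z ∘ ⊑-app) (λ c → agreeᶜ c ∘ ⊑-app))
    evals-coincidence k r r′ [] agreeᵛ agreeᶜ = refl
    evals-coincidence k r r′ (u ∷ us) agreeᵛ agreeᶜ = cong₂ _∷_
      (eval-coincidence k r r′ u (λ z → agreeᵛ z ∘ ⊑-hd) (λ c → agreeᶜ c ∘ ⊑-hd))
      (evals-coincidence k r r′ us (λ z → agreeᵛ z ∘ ⊑-tl) (λ c → agreeᶜ c ∘ ⊑-tl))

    sat-coincidence : ∀ (k : Const → D 𝔄) A (r r′ : Var → D 𝔄) →
      (∀ z → FreeIn L z A → r z ≡ r′ z) → (∀ c → Occurs L (con c) A → conI 𝔄 c ≡ k c) →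
      Sat L 𝔄 A r ⇔ Sat L (𝔄 ⟨ k ⟩) A r′
    sat-coincidence k (u ≐ v) r r′ agreeᵛ agreeᶜ = ≡⇒⇔ (cong₂ _≡_
      (eval-coincidence k r r′ u (λ z → agreeᵛ z ∘ fr-eqˡ) (λ c → agreeᶜ c ∘ oc-eqˡ))
      (eval-coincidence k r r′ v (λ z → agreeᵛ z ∘ fr-eqʳ) (λ c → agreeᶜ c ∘ oc-eqʳ)))
    sat-coincidence k (E! u) r r′ agreeᵛ agreeᶜ = ≡⇒⇔ (cong (Inner 𝔄)
      (eval-coincidence k r r′ u (λ z → agreeᵛ z ∘ fr-ex) (λ c → agreeᶜ c ∘ oc-ex)))
    sat-coincidence k (rel P us) r r′ agreeᵛ agreeᶜ = ≡⇒⇔ (cong (relI 𝔄 P)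
      (evals-coincidence k r r′ us (λ z → agreeᵛ z ∘ fr-rel) (λ c → agreeᶜ c ∘ oc-rel)))
    sat-coincidence k (¬′ A) r r′ agreeᵛ agreeᶜ =
      ¬-cong-⇔ (sat-coincidence k A r r′ (λ z → agreeᵛ z ∘ fr-neg) (λ c → agreeᶜ c ∘ oc-neg))
    sat-coincidence k (A ⇒′ B) r r′ agreeᵛ agreeᶜ = →-cong-⇔
      (sat-coincidence k A r r′ (λ z → agreeᵛ z ∘ fr-impˡ) (λ c → agreeᶜ c ∘ oc-impˡ))
      (sat-coincidence k B r r′ (λ z → agreeᵛ z ∘ fr-impʳ) (λ c → agreeᶜ c ∘ oc-impʳ))
    sat-coincidence k (all y A) r r′ agreeᵛ agreeᶜ = ∀-cong λ d →
      sat-coincidence k A _ _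
        (update-agree k (λ z → FreeIn L z A) y d (λ z y≢z → agreeᵛ z ∘ fr-all y≢z))
        (λ c → agreeᶜ c ∘ oc-all)
    sat-coincidence k (I y A B) r r′ agreeᵛ agreeᶜ = I-cong
      (λ d → sat-coincidence k A _ _
        (update-agree k (λ z → FreeIn L z A) y d (λ z y≢z → agreeᵛ z ∘ fr-Iˡ y≢z))
        (λ c → agreeᶜ c ∘ oc-Iˡ))
      (λ d → sat-coincidence k B _ _
        (update-agree k (λ z → FreeIn L z B) y d (λ z y≢z → agreeᵛ z ∘ fr-Iʳ y≢z))
        (λ c → agreeᶜ c ∘ oc-Iʳ))

    sat-extensional : ∀ A {r r′ : Var → D 𝔄} → r ≗ r′ → Sat L 𝔄 A r ⇔ Sat L 𝔄 A r′
    sat-extensional A r≗r′ = sat-coincidence (conI 𝔄) A _ _ (λ z _ → r≗r′ z) (λ _ _ → refl)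

    sat-update-nonfree : ∀ A {x} → ¬ FreeIn L x A → ∀ (r : Var → D 𝔄) d →
      Sat L 𝔄 A r ⇔ Sat L 𝔄 A (update L 𝔄 r x d)
    sat-update-nonfree A {x} x∉A r d = sat-coincidence (conI 𝔄) A _ _ agree (λ _ _ → refl)
      where
        agree : ∀ z → FreeIn L z A → r z ≡ update L 𝔄 r x d z
        agree z z∈A = sym (update-other 𝔄 r x d z λ { refl → x∉A z∈A })

    eval-update-nonfree : ∀ (r : Var → D 𝔄) {y} d t → ¬ (var y ≼ t) →
      eval L 𝔄 (update L 𝔄 r y d) t ≡ eval L 𝔄 r t
    eval-update-nonfree r {y} d t y∉t = eval-coincidence (conI 𝔄) _ _ t agree (λ _ _ → refl)
      where
        agree : ∀ z → var z ≼ t → update L 𝔄 r y d z ≡ r z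
        agree z z∈t = update-other 𝔄 r y d z λ { refl → y∉t z∈t }

    eval-substT : ∀ (r : Var → D 𝔄) x t u →
      eval L 𝔄 r (substT L u x t) ≡ eval L 𝔄 (update L 𝔄 r x (eval L 𝔄 r t)) u
    evals-substTs : ∀ (r : Var → D 𝔄) x t {n} (us : Vec (Term L) n) →
      evals L 𝔄 r (substTs L us x t) ≡ evals L 𝔄 (update L 𝔄 r x (eval L 𝔄 r t)) us
    eval-substT r x t (var y) with y ≟ x
    ... | yes _ = refl
    ... | no _ = refl
    eval-substT r x t (con c) = refl
    eval-substT r x t (app f us) = cong (funI 𝔄 f) (evals-substTs r x t us)
    evals-substTs r x t [] = refl
    evals-substTs r x t (u ∷ us) = cong₂ _∷_ (eval-substT r x t u) (evals-substTs r x t us)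

    sat-sub-nonfree : ∀ A {x} t → ¬ FreeIn L x A → ∀ (r : Var → D 𝔄) d →
      Sat L 𝔄 (sub L A x t) r ⇔ Sat L 𝔄 A (update L 𝔄 r x d)
    sat-sub-nonfree A t x∉A r d =
      ⇔-trans (≡⇒⇔ (cong (λ F → Sat L 𝔄 F r) (sub-nonfree A _ t x∉A)))
              (sat-update-nonfree A x∉A r d)

    sat-sub : ∀ A x t → FreeFor L t x A → ∀ (r : Var → D 𝔄) →
      Sat L 𝔄 (sub L A x t) r ⇔ Sat L 𝔄 A (update L 𝔄 r x (eval L 𝔄 r t))
    sat-sub-binder : ∀ A {x y} t → y ≢ x → ¬ (var y ≼ t) → FreeFor L t x A → ∀ (r : Var → D 𝔄) d →
      Sat L 𝔄 (sub L A x t) (update L 𝔄 r y d)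
        ⇔ Sat L 𝔄 A (update L 𝔄 (update L 𝔄 r x (eval L 𝔄 r t)) y d)
    sat-sub (u ≐ v) x t _ r = ≡⇒⇔ (cong₂ _≡_ (eval-substT r x t u) (eval-substT r x t v))
    sat-sub (E! u) x t _ r = ≡⇒⇔ (cong (Inner 𝔄) (eval-substT r x t u))
    sat-sub (rel P us) x t _ r = ≡⇒⇔ (cong (relI 𝔄 P) (evals-substTs r x t us))
    sat-sub (¬′ A) x t ff r = ¬-cong-⇔ (sat-sub A x t ff r)
    sat-sub (A ⇒′ B) x t (ffA , ffB) r = →-cong-⇔ (sat-sub A x t ffA r) (sat-sub B x t ffB r)
    sat-sub (all y A) x t (inj₁ x∉∀A) r = sat-sub-nonfree (all y A) t x∉∀A r _
    sat-sub (all y A) x t (inj₂ (y∉t , ff)) r with y ≟ x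
    ... | yes y≡x = sat-update-nonfree (all y A) (λ { (fr-all y≢x _) → y≢x y≡x }) r _
    ... | no y≢x = ∀-cong (sat-sub-binder A t y≢x y∉t ff r)
    sat-sub (I y A B) x t (inj₁ x∉IAB) r = sat-sub-nonfree (I y A B) t x∉IAB r _
    sat-sub (I y A B) x t (inj₂ (y∉t , ffA , ffB)) r with y ≟ x
    ... | yes y≡x = sat-update-nonfree (I y A B)
      (λ { (fr-Iˡ y≢x _) → y≢x y≡x ; (fr-Iʳ y≢x _) → y≢x y≡x }) r _
    ... | no y≢x = I-cong (sat-sub-binder A t y≢x y∉t ffA r) (sat-sub-binder B t y≢x y∉t ffB r)
    sat-sub-binder A {x} {y} t y≢x y∉t ff r d =
      ⇔-trans (sat-sub A x t ff (update L 𝔄 r y d)) (sat-extensional A swap)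
      where
        swap : update L 𝔄 (update L 𝔄 r y d) x (eval L 𝔄 (update L 𝔄 r y d) t)
             ≗ update L 𝔄 (update L 𝔄 r x (eval L 𝔄 r t)) y d
        swap z = trans
          (cong (λ e → update L 𝔄 (update L 𝔄 r y d) x e z) (eval-update-nonfree r d t y∉t))
          (update-comm r d (eval L 𝔄 r t) y≢x z)

    sat-sub-cong : ∀ A x {t₁ t₂} {r : Var → D 𝔄} → FreeFor L t₁ x A → FreeFor L t₂ x A →
      eval L 𝔄 r t₁ ≡ eval L 𝔄 r t₂ → Sat L 𝔄 (sub L A x t₁) r → Sat L 𝔄 (sub L A x t₂) r
    sat-sub-cong A x {r = r} ff₁ ff₂ t₁≡t₂ =
      from (sat-sub A x _ ff₂ r)
      ∘ subst (λ e → Sat L 𝔄 A (update L 𝔄 r x e)) t₁≡t₂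
      ∘ to (sat-sub A x _ ff₁ r)

  record Variant (𝔄 : Structure L) (s : Var → D 𝔄) (a : Term L) (d : D 𝔄) : Set where
    field
      consts       : Const → D 𝔄
      assignment   : Var → D 𝔄
      denotes      : eval L (𝔄 ⟨ consts ⟩) assignment a ≡ d
      vars-agree   : ∀ z → a ≢ var z → s z ≡ assignment z
      consts-agree : ∀ c → a ≢ con c → conI 𝔄 c ≡ consts c

  module _ {𝔄 : Structure L} {s : Var → D 𝔄} {a : Term L} {d : D 𝔄} (v : Variant 𝔄 s a d) where
    open Variant v

    private
      𝔅 : Structure L
      𝔅 = 𝔄 ⟨ consts ⟩

      vars-agree-on : ∀ {F} → ¬ Occurs L a F → ∀ z → FreeIn L z F → s z ≡ assignment z
      vars-agree-on {F} a∉F z z∈F =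
        vars-agree z λ a≡z → a∉F (subst (λ b → Occurs L b F) (sym a≡z) (free⇒occurs z∈F))

      consts-agree-on : ∀ {F} → ¬ Occurs L a F → ∀ c → Occurs L (con c) F → conI 𝔄 c ≡ consts c
      consts-agree-on {F} a∉F c c∈F =
        consts-agree c λ a≡c → a∉F (subst (λ b → Occurs L b F) (sym a≡c) c∈F)

    sat-variant : ∀ F → ¬ Occurs L a F → Sat L 𝔄 F s ⇔ Sat L 𝔅 F assignment
    sat-variant F a∉F =
      sat-coincidence 𝔄 consts F s assignment (vars-agree-on a∉F) (consts-agree-on a∉F)

    sat-variant-sub : ∀ A x → FreeFor L a x A → ¬ Occurs L a A →
      Sat L 𝔅 (sub L A x a) assignment ⇔ Sat L 𝔄 A (update L 𝔄 s x d)
    sat-variant-sub A x ff a∉A = ⇔-trans (sat-sub 𝔅 A x a ff assignment)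
      (⇔-sym (sat-coincidence 𝔄 consts A _ _ agree (consts-agree-on a∉A)))
      where
        agree : ∀ z → FreeIn L z A →
          update L 𝔄 s x d z ≡ update L 𝔅 assignment x (eval L 𝔅 assignment a) z
        agree z z∈A = trans
          (update-agree 𝔄 consts (λ z → FreeIn L z A) x d (λ z _ → vars-agree-on a∉A z) z z∈A)
          (cong (λ e → update L 𝔅 assignment x e z) (sym denotes))

    eval-variant : ∀ t → ¬ (a ≼ t) → eval L 𝔄 s t ≡ eval L 𝔅 assignment t
    eval-variant t a∉t = eval-coincidence 𝔄 consts s assignment t
      (λ z z∈t → vars-agree z λ a≡z → a∉t (subst (_≼ t) (sym a≡z) z∈t))
      (λ c c∈t → consts-agree c λ a≡c → a∉t (subst (_≼ t) (sym a≡c) c∈t))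

    all-variant : ∀ {Γ} → ¬ Any (Occurs L a) Γ →
      All (λ F → Sat L 𝔄 F s) Γ → All (λ F → Sat L 𝔅 F assignment) Γ
    all-variant {Γ} a∉Γ γ =
      All.zipWith (λ (a∉F , Fs) → to (sat-variant _ a∉F) Fs) (¬Any⇒All¬ Γ a∉Γ , γ)

    any-variant : ∀ {Δ} → ¬ Any (Occurs L a) Δ →
      Any (λ F → Sat L 𝔅 F assignment) Δ → Any (λ F → Sat L 𝔄 F s) Δ
    any-variant a∉Δ (here Fs) = here (from (sat-variant _ (a∉Δ ∘ here)) Fs)
    any-variant a∉Δ (there δ) = there (any-variant (a∉Δ ∘ there) δ)

  module _ (em : ExcludedMiddle 0ℓ) where

    variant : ∀ {a} → Eigen L a → (𝔄 : Structure L) (s : Var → D 𝔄) (d : D 𝔄) → Variant 𝔄 s a d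
    variant (e-var {y}) 𝔄 s d = record
      { consts = conI 𝔄
      ; assignment = update L 𝔄 s y d
      ; denotes = update-same 𝔄 s y d
      ; vars-agree = λ z y≢z → sym (update-other 𝔄 s y d z λ { refl → y≢z refl })
      ; consts-agree = λ _ _ → refl
      }
    variant (e-con {c}) 𝔄 s d = record
      { consts = λ c′ → reassign c′ em
      ; assignment = s
      ; denotes = reassign-same em
      ; vars-agree = λ _ _ → refl
      ; consts-agree = λ c′ c≢c′ → reassign-other c′ c≢c′ em
      }
      where
        reassign : ∀ c′ → Dec (c′ ≡ c) → D 𝔄
        reassign c′ (yes _) = d
        reassign c′ (no _) = conI 𝔄 c′
        reassign-same : (c≟c : Dec (c ≡ c)) → reassign c c≟c ≡ d
        reassign-same (yes _) = refl
        reassign-same (no c≢c) = contradiction refl c≢c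
        reassign-other : ∀ c′ → con c ≢ con c′ → (c′≟c : Dec (c′ ≡ c)) →
          conI 𝔄 c′ ≡ reassign c′ c′≟c
        reassign-other c′ c≢c′ (yes refl) = contradiction refl c≢c′
        reassign-other c′ c≢c′ (no _) = refl

    here-unless-there : ∀ {P : Formula L → Set} {F Δ} → (¬ Any P Δ → P F) → Any P (F ∷ Δ)
    here-unless-there {P} {Δ = Δ} PF with em {Any P Δ}
    ... | yes PΔ = there PΔ
    ... | no ¬PΔ = here (PF ¬PΔ)

    R∀-valid : ∀ {Γ Δ x A a} → Eigen L a → FreeFor L a x A → ¬ OccursSeq L a Γ (all x A ∷ Δ) →
      Valid L (E! a ∷ Γ) (sub L A x a ∷ Δ) → Valid L Γ (all x A ∷ Δ)
    R∀-valid {Δ = Δ} {x} {A} eig ff a∉ premise 𝔄 s γ = here-unless-there ∀A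
      where
        ∀A : ¬ Any (λ F → Sat L 𝔄 F s) Δ → Sat L 𝔄 (all x A) s
        ∀A ¬Δ d d∈ = to (sat-variant-sub v A x ff (a∉ ∘ inj₂ ∘ here ∘ oc-all))
          (Any.head (¬Δ ∘ any-variant v (a∉ ∘ inj₂ ∘ there))
            (premise _ _ ( subst (Inner 𝔄) (sym (Variant.denotes v)) d∈
                         ∷ all-variant v (a∉ ∘ inj₁) γ)))
          where v = variant eig 𝔄 s d

    RI-valid : ∀ {Γ Δ x A B t a} → FreeFor L t x A → FreeFor L t x B →
      Eigen L a → FreeFor L a x A → ¬ OccursSeq L a Γ (I x A B ∷ Δ) → ¬ (a ≼ t) →
      Valid L Γ (sub L A x t ∷ Δ) → Valid L Γ (sub L B x t ∷ Δ) →
      Valid L (sub L A x a ∷ Γ) ((a ≐ t) ∷ Δ) → Valid L Γ (I x A B ∷ Δ)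
    RI-valid {Δ = Δ} {x} {A} {B} {t} {a} fftA fftB eig ffa a∉ a∉t premiseA premiseB premise= 𝔄 s γ
      =
      here-unless-there λ ¬Δ →
        eval L 𝔄 s t
        , to (sat-sub 𝔄 A x t fftA s) (Any.head ¬Δ (premiseA 𝔄 s γ))
        , unique ¬Δ
        , to (sat-sub 𝔄 B x t fftB s) (Any.head ¬Δ (premiseB 𝔄 s γ))
      where
        unique : ¬ Any (λ F → Sat L 𝔄 F s) Δ →
          ∀ e → e ≢ eval L 𝔄 s t → ¬ Sat L 𝔄 A (update L 𝔄 s x e)
        unique ¬Δ e e≢t Ae = e≢t (begin
          e                                    ≡⟨ Variant.denotes v ⟨
          eval L _ (Variant.assignment v) a    ≡⟨ a≐t ⟩
          eval L _ (Variant.assignment v) t    ≡⟨ eval-variant v t a∉t ⟨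
          eval L 𝔄 s t                          ∎)
          where
            open ≡-Reasoning
            v = variant eig 𝔄 s e
            a≐t = Any.head (¬Δ ∘ any-variant v (a∉ ∘ inj₂ ∘ there))
              (premise= _ _ (from (sat-variant-sub v A x ffa (a∉ ∘ inj₂ ∘ here ∘ oc-Iˡ)) Ae
                             ∷ all-variant v (a∉ ∘ inj₁) γ))

    LI¹-valid : ∀ {Γ Δ x A B a} → Eigen L a → FreeFor L a x A → FreeFor L a x B →
      ¬ OccursSeq L a (I x A B ∷ Γ) Δ →
      Valid L (sub L A x a ∷ sub L B x a ∷ Γ) Δ → Valid L (I x A B ∷ Γ) Δ
    LI¹-valid {x = x} {A} {B} eig ffA ffB a∉ premise 𝔄 s ((d , Ad , _ , Bd) ∷ γ) =
      any-variant v (a∉ ∘ inj₂) (premise _ _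
        ( from (sat-variant-sub v A x ffA (a∉ ∘ inj₁ ∘ here ∘ oc-Iˡ)) Ad
        ∷ from (sat-variant-sub v B x ffB (a∉ ∘ inj₁ ∘ here ∘ oc-Iʳ)) Bd
        ∷ all-variant v (a∉ ∘ inj₁ ∘ there) γ))
      where v = variant eig 𝔄 s d

    LI²-valid : ∀ {Γ Δ x A B C t₁ t₂} → Atomic L C → FreeFor L t₁ x A → FreeFor L t₂ x A →
      Valid L Γ (sub L A x t₁ ∷ Δ) → Valid L Γ (sub L A x t₂ ∷ Δ) → Valid L Γ (sub L C x t₂ ∷ Δ) →
      Valid L (I x A B ∷ Γ) (sub L C x t₁ ∷ Δ)
    LI²-valid {Δ = Δ} {x} {A} {C = C} {t₁} {t₂} at ff₁ ff₂ premise₁ premise₂ premiseC 𝔄 s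
              ((d , _ , unique , _) ∷ γ) =
      here-unless-there λ ¬Δ →
        sat-sub-cong 𝔄 C x (atomic⇒freeFor at) (atomic⇒freeFor at)
          (trans (is-d t₂ ff₂ (premise₂ 𝔄 s γ) ¬Δ) (sym (is-d t₁ ff₁ (premise₁ 𝔄 s γ) ¬Δ)))
          (Any.head ¬Δ (premiseC 𝔄 s γ))
      where
        is-d : ∀ t → FreeFor L t x A → Any (λ F → Sat L 𝔄 F s) (sub L A x t ∷ Δ) →
          ¬ Any (λ F → Sat L 𝔄 F s) Δ → eval L 𝔄 s t ≡ d
        is-d t ff At ¬Δ = decidable-stable em λ t≢d →
          unique _ t≢d (to (sat-sub 𝔄 A x t ff s) (Any.head ¬Δ At))

    sound : ∀ {Γ Δ} → Derivable L Γ Δ → Valid L Γ Δ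
    sound ax 𝔄 s (A ∷ []) = here A
    sound (cut ⊢A ⊢A′) 𝔄 s γ with sound ⊢A 𝔄 s γ
    ... | here A = sound ⊢A′ 𝔄 s (A ∷ γ)
    ... | there δ = δ
    sound (wk Γ⊆ Δ⊆ ⊢) 𝔄 s γ = Any-resp-⊆ Δ⊆ (sound ⊢ 𝔄 s (All-resp-⊇ Γ⊆ γ))
    sound (L¬ ⊢) 𝔄 s (¬A ∷ γ) = Any.tail ¬A (sound ⊢ 𝔄 s γ)
    sound (R¬ ⊢) 𝔄 s γ = here-unless-there λ ¬Δ A → ¬Δ (sound ⊢ 𝔄 s (A ∷ γ))
    sound (L⇒ ⊢A ⊢B) 𝔄 s (A⇒B ∷ γ) with sound ⊢A 𝔄 s γ
    ... | here A = sound ⊢B 𝔄 s (A⇒B A ∷ γ)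
    ... | there δ = δ
    sound (R⇒ ⊢) 𝔄 s γ = here-unless-there λ ¬Δ A → Any.head ¬Δ (sound ⊢ 𝔄 s (A ∷ γ))
    sound (L∀ {x = x} {A} {t} ff ⊢) 𝔄 s (E!t ∷ ∀A ∷ γ) =
      sound ⊢ 𝔄 s (from (sat-sub 𝔄 A x t ff s) (∀A _ E!t) ∷ γ)
    sound (R∀ eig ff a∉ ⊢) = R∀-valid eig ff a∉ (sound ⊢)
    sound (id= {x = x} {A} at ⊢) 𝔄 s (t₁≡t₂ ∷ At₁ ∷ γ) =
      sound ⊢ 𝔄 s (sat-sub-cong 𝔄 A x (atomic⇒freeFor at) (atomic⇒freeFor at) t₁≡t₂ At₁ ∷ γ)
    sound (refl= ⊢) 𝔄 s γ = sound ⊢ 𝔄 s (refl ∷ γ)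
    sound (RI fftA fftB eig ffa a∉ a∉t ⊢A ⊢B ⊢=) =
      RI-valid fftA fftB eig ffa a∉ a∉t (sound ⊢A) (sound ⊢B) (sound ⊢=)
    sound (LI¹ eig ffA ffB a∉ ⊢) = LI¹-valid eig ffA ffB a∉ (sound ⊢)
    sound (LI² at ff₁ ff₂ ⊢₁ ⊢₂ ⊢C) = LI²-valid at ff₁ ff₂ (sound ⊢₁) (sound ⊢₂) (sound ⊢C)

theorem2 : ExcludedMiddle 0ℓ → (L : Signature) {Γ Δ : List (Formula L)} →
    Derivable L Γ Δ → Valid L Γ Δ
theorem2 em L = sound L em
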